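{- If $G$ is a graph with no isolated vertices and minimum degree $\delta(G)$, then $d_g(G)\le \frac{\delta(G)+3}{2}$ and $d_g'(G)\le \frac{\delta(G)+3}{2}$ if $\delta(G)$ is odd, and $d_g(G)\le \frac{\delta(G)+2}{2}$ and $d_g'(G)\le \frac{\delta(G)+2}{2}$ if $\delta(G)$ is even.
   Context: All graphs are finite and simple. For a vertex $x$, $N[x]$ denotes its closed neighborhood. The domatic number game on $G$ with palette $[k]=\{1,\dots,k\}$: two players, Alice and Bob, alternately choose a previously unchosen vertex of $G$ and assign it a color from $[k]$, until every vertex has been colored. Let $V_i$ be the set of vertices colored $i$. Alice wins if every $V_i$ ($i\in[k]$) is a dominating set of $G$, i.e. for every vertex $x$ and every color $c\in[k]$ some vertex of $N[x]$ has color $c$; otherwise Bob wins. In the $A$-game Alice moves first; in the $B$-game Bob moves first. The game domatic number $d_g(G)$ is the largest $k$ for which Alice has a winning strategy in the $A$-game with palette $[k]$, and the delayed game domatic number $d_g'(G)$ is the largest $k$ for which Alice has a winning strategy in the $B$-game with palette $[k]$. -}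

module Defs where

open import Data.Nat using (ℕ; zero; suc; _+_; _≤_)
open import Data.Fin using (Fin)
open import Data.Fin.Properties using () renaming (_≟_ to _≟ᶠ_)
open import Data.Bool using (Bool; true; false; if_then_else_)
open import Data.Maybe using (Maybe; just; nothing)
open import Data.List using (List; map; allFin)
open import Data.Nat.ListAction using (sum)
open import Data.Product using (Σ; ∃; _×_; _,_)
open import Data.Sum using (_⊎_)
open import Relation.Nullary using (yes; no)
open import Relation.Binary.PropositionalEquality using (_≡_)

record Graph (n : ℕ) : Set where
  field
    adj   : Fin n → Fin n → Bool
    sym   : ∀ u v → adj u v ≡ adj v u
    irrefl : ∀ v → adj v v ≡ false
open Graph public

degree : ∀ {n} → Graph n → Fin n → ℕ
degree {n} G v = sum (map (λ u → if adj G v u then 1 else 0) (allFin n))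

IsMinDegree : ∀ {n} → Graph n → ℕ → Set
IsMinDegree {n} G δ = (∃ λ v → degree G v ≡ δ) × (∀ v → δ ≤ degree G v)

NoIsolatedVertices : ∀ {n} → Graph n → Set
NoIsolatedVertices {n} G = ∀ (v : Fin n) → ∃ λ u → adj G v u ≡ true

InClosedNbhd : ∀ {n} → Graph n → Fin n → Fin n → Set
InClosedNbhd G x y = (y ≡ x) ⊎ (adj G x y ≡ true)

-- A (partial) colouring with palette [k] = Fin k; nothing = uncoloured.
State : ℕ → ℕ → Set
State n k = Fin n → Maybe (Fin k)

assign : ∀ {n k} → State n k → Fin n → Fin k → State n k
assign s v c w with w ≟ᶠ v
... | yes _ = just c
... | no  _ = s w

Full : ∀ {n k} → State n k → Set
Full s = ∀ v → ∃ λ c → s v ≡ just c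

AllClassesDominate : ∀ {n k} → Graph n → State n k → Set
AllClassesDominate G s = ∀ x c → ∃ λ y → InClosedNbhd G x y × (s y ≡ just c)

data Player : Set where
  alice bob : Player

-- AliceWins G s p : Alice has a winning strategy from position s with
-- player p to move.
data AliceWins {n k : ℕ} (G : Graph n) : State n k → Player → Set where
  finished : ∀ {s p} → Full s → AllClassesDominate G s → AliceWins G s p
  aliceMove : ∀ {s} (v : Fin n) (c : Fin k) → s v ≡ nothing →
              AliceWins G (assign s v c) bob → AliceWins G s alice
  bobMove : ∀ {s} → (∃ λ v → s v ≡ nothing) →
            (∀ (v : Fin n) (c : Fin k) → s v ≡ nothing →
               AliceWins G (assign s v c) alice) → AliceWins G s bob

empty : ∀ {n k} → State n k
empty _ = nothing

AliceWinsAGame : ∀ {n} → Graph n → ℕ → Set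
AliceWinsAGame {n} G k = AliceWins {n} {k} G empty alice

AliceWinsBGame : ∀ {n} → Graph n → ℕ → Set
AliceWinsBGame {n} G k = AliceWins {n} {k} G empty bob

{-# OPTIONS --safe #-}

-- Fix a vertex x of minimum degree δ, so |N[x]| = δ + 1, and measure a position by
-- Φ = 2·(number of colours seen in N[x]) + (number of uncoloured vertices of N[x]).
-- A win for Alice needs every colour in N[x], so Φ ≥ 2k at the end. Initially
-- Φ ≤ δ + 1; a move of Alice raises Φ by at most one, and can only do so while N[x]
-- has an uncoloured vertex. In that situation Bob answers inside N[x], repeating a
-- colour already seen there (Φ drops by one) or, if none is seen yet, using any
-- colour (Φ ≤ δ + 2 afterwards). So Φ ≤ δ + 3 throughout; for even δ parity
-- sharpens 2k ≤ δ + 3 to 2k ≤ δ + 2.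
module Submission where

open import Level using (Level)
open import Defs hiding (sym)
open import Data.Nat using (ℕ; zero; suc; _+_; _*_; _≤_; _<_; _%_; z≤n; s≤s; s≤s⁻¹)
open import Data.Nat.Properties
  using (≤-reflexive; ≤-trans; <-≤-trans; m≤n⇒m≤1+n; m<n⇒m<1+n; n≮0; n≤0⇒n≡0; m≤m+n;
         m≤n⇒m<n∨m≡n; +-comm; +-suc; *-suc; +-mono-≤; +-monoˡ-≤; +-monoʳ-<; +-mono-≤-<;
         *-monoʳ-≤; module ≤-Reasoning)
open import Data.Nat.DivMod using ([m+n]%n≡m%n)
open import Data.Nat.Divisibility using (_∣_; m%n≡0⇒n∣m; m∣m*n; ∣m+n∣m⇒∣n; ∣1⇒≡1)
open import Data.Nat.ListAction using (sum)
open import Data.Fin using (Fin) renaming (zero to fzero; suc to fsuc)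
open import Data.Fin.Properties using (any?) renaming (_≟_ to _≟ᶠ_; suc-injective to fsuc-injective)
open import Data.Bool using (Bool; true; false; if_then_else_)
open import Data.Bool.Properties using () renaming (_≟_ to _≟ᵇ_)
open import Data.Maybe using (just; nothing)
open import Data.Maybe.Properties using (just-injective; ≡-dec)
open import Data.List using (tabulate)
open import Data.List.Properties using (map-tabulate)
open import Data.Product using (_×_; _,_; ∃; ∃₂; proj₁; map₂; curry)
open import Data.Sum using (_⊎_; inj₁; inj₂; [_,_]′; map₁)
open import Data.Empty using (⊥-elim)
open import Function using (_∘_; id)
open import Relation.Nullary using (¬_; yes; no; does; contradiction; _×-dec_)
open import Relation.Unary using (Pred; Decidable; _⊆_; _∪_; _∩_; ｛_｝; Empty; Universal)
open import Relation.Unary.Properties using (_∪?_; _∩?_)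
open import Relation.Binary.PropositionalEquality using (_≡_; refl; sym; trans; cong; subst)

private variable
  n k : ℕ
  p q : Level

count : {P : Pred (Fin n) p} → Decidable P → ℕ
count {n = zero}  P? = 0
count {n = suc n} P? = if does (P? fzero) then suc (count (P? ∘ fsuc)) else count (P? ∘ fsuc)

count-mono : {P : Pred (Fin n) p} {Q : Pred (Fin n) q} (P? : Decidable P) (Q? : Decidable Q) →
             P ⊆ Q → count P? ≤ count Q?
count-mono {n = zero}  P? Q? P⊆Q = z≤n
count-mono {n = suc n} P? Q? P⊆Q
  with P? fzero | Q? fzero | count-mono (P? ∘ fsuc) (Q? ∘ fsuc) P⊆Q
... | yes P0 | no ¬Q0 | _  = contradiction (P⊆Q P0) ¬Q0
... | yes _  | yes _  | ih = s≤s ih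
... | no _   | yes _  | ih = m≤n⇒m≤1+n ih
... | no _   | no _   | ih = ih

count-≤-suc : {P : Pred (Fin n) p} {Q : Pred (Fin n) q}
              (P? : Decidable P) (Q? : Decidable Q) (v : Fin n) →
              P ⊆ ｛ v ｝ ∪ Q → count P? ≤ suc (count Q?)
count-≤-suc {n = suc n} P? Q? fzero P⊆v∪Q
  with P? fzero | Q? fzero | count-mono (P? ∘ fsuc) (Q? ∘ fsuc) ([ (λ ()) , id ]′ ∘ P⊆v∪Q)
... | yes _ | yes _ | ih = s≤s (m≤n⇒m≤1+n ih)
... | yes _ | no _  | ih = s≤s ih
... | no _  | yes _ | ih = m≤n⇒m≤1+n (m≤n⇒m≤1+n ih)
... | no _  | no _  | ih = m≤n⇒m≤1+n ih
count-≤-suc {n = suc n} P? Q? (fsuc v) P⊆v∪Q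
  with P? fzero | Q? fzero | count-≤-suc (P? ∘ fsuc) (Q? ∘ fsuc) v (map₁ fsuc-injective ∘ P⊆v∪Q)
... | yes P0 | no ¬Q0 | _  = ⊥-elim ([ (λ ()) , ¬Q0 ]′ (P⊆v∪Q P0))
... | yes _  | yes _  | ih = s≤s ih
... | no _   | yes _  | ih = m≤n⇒m≤1+n ih
... | no _   | no _   | ih = ih

count-< : {P : Pred (Fin n) p} {Q : Pred (Fin n) q}
          (P? : Decidable P) (Q? : Decidable Q) {v : Fin n} →
          P ⊆ Q → ¬ P v → Q v → count P? < count Q?
count-< {n = suc n} P? Q? {fzero} P⊆Q ¬Pv Qv
  with P? fzero | Q? fzero | count-mono (P? ∘ fsuc) (Q? ∘ fsuc) P⊆Q
... | yes P0 | _      | _  = contradiction P0 ¬Pv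
... | no _   | no ¬Q0 | _  = contradiction Qv ¬Q0
... | no _   | yes _  | ih = s≤s ih
count-< {n = suc n} P? Q? {fsuc v} P⊆Q ¬Pv Qv
  with P? fzero | Q? fzero | count-< (P? ∘ fsuc) (Q? ∘ fsuc) P⊆Q ¬Pv Qv
... | yes P0 | no ¬Q0 | _  = contradiction (P⊆Q P0) ¬Q0
... | yes _  | yes _  | ih = s≤s ih
... | no _   | yes _  | ih = m<n⇒m<1+n ih
... | no _   | no _   | ih = ih

count-none : {P : Pred (Fin n) p} (P? : Decidable P) → Empty P → count P? ≡ 0
count-none {n = zero}  P? ∅ = refl
count-none {n = suc n} P? ∅ with P? fzero
... | yes P0 = contradiction P0 (∅ fzero)
... | no _   = count-none (P? ∘ fsuc) (∅ ∘ fsuc)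

count-all : {P : Pred (Fin n) p} (P? : Decidable P) → Universal P → count P? ≡ n
count-all {n = zero}  P? all = refl
count-all {n = suc n} P? all with P? fzero
... | yes _   = cong suc (count-all (P? ∘ fsuc) (all ∘ fsuc))
... | no ¬P0  = contradiction (all fzero) ¬P0

count-true : (b : Fin n → Bool) →
             count (λ i → b i ≟ᵇ true) ≡ sum (tabulate (λ i → if b i then 1 else 0))
count-true {n = zero}  b = refl
count-true {n = suc n} b with b fzero
... | true  = cong suc (count-true (b ∘ fsuc))
... | false = count-true (b ∘ fsuc)

degree≡count : (G : Graph n) (x : Fin n) → degree G x ≡ count (λ y → adj G x y ≟ᵇ true)
degree≡count G x =
  trans (cong sum (map-tabulate id (λ y → if adj G x y then 1 else 0))) (sym (count-true (adj G x)))

assign-same : (s : State n k) (v : Fin n) (c : Fin k) → assign s v c v ≡ just c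
assign-same s v c with v ≟ᶠ v
... | yes _   = refl
... | no v≢v  = contradiction refl v≢v

assign-nothing : (s : State n k) (v : Fin n) (c : Fin k) {w : Fin n} →
                 assign s v c w ≡ nothing → s w ≡ nothing
assign-nothing s v c {w} eq with w ≟ᶠ v
... | yes _ = contradiction eq λ ()
... | no _  = eq

assign-just : (s : State n k) (v : Fin n) (c : Fin k) {w : Fin n} {c′ : Fin k} →
              assign s v c w ≡ just c′ → (w ≡ v × c ≡ c′) ⊎ s w ≡ just c′
assign-just s v c {w} eq with w ≟ᶠ v
... | yes w≡v = inj₁ (w≡v , just-injective eq)
... | no _    = inj₂ eq

module Potential {n k : ℕ} (G : Graph n) (x : Fin n) where

  inN[x]? : Decidable (InClosedNbhd G x)
  inN[x]? = (_≟ᶠ x) ∪? (λ y → adj G x y ≟ᵇ true)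

  Uncoloured : State n k → Pred (Fin n) _
  Uncoloured s = InClosedNbhd G x ∩ (λ y → s y ≡ nothing)

  uncoloured? : (s : State n k) → Decidable (Uncoloured s)
  uncoloured? s = inN[x]? ∩? (λ y → ≡-dec _≟ᶠ_ (s y) nothing)

  Seen : State n k → Pred (Fin k) _
  Seen s c = ∃ λ y → InClosedNbhd G x y × s y ≡ just c

  seen? : (s : State n k) → Decidable (Seen s)
  seen? s c = any? (λ y → inN[x]? y ×-dec ≡-dec _≟ᶠ_ (s y) (just c))

  #uncoloured #seen Φ : State n k → ℕ
  #uncoloured s = count (uncoloured? s)
  #seen s = count (seen? s)
  Φ s = 2 * #seen s + #uncoloured s

  #uncoloured≤1+degree : ∀ s → #uncoloured s ≤ suc (degree G x)
  #uncoloured≤1+degree s = begin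
    #uncoloured s     ≤⟨ count-≤-suc (uncoloured? s) adj? x (map₁ sym ∘ proj₁) ⟩
    suc (count adj?)  ≡⟨ cong suc (degree≡count G x) ⟨
    suc (degree G x)  ∎
    where
    open ≤-Reasoning
    adj? : Decidable (λ y → adj G x y ≡ true)
    adj? y = adj G x y ≟ᵇ true

  #seen-empty : #seen empty ≡ 0
  #seen-empty = count-none (seen? empty) (λ { _ (_ , _ , ()) })

  #seen-full : ∀ {s} → AllClassesDominate G s → k ≤ #seen s
  #seen-full {s} dominates = ≤-reflexive (sym (count-all (seen? s) (dominates x)))

  Φ-mono : ∀ {s t} → #seen s ≤ #seen t → #uncoloured s ≤ #uncoloured t → Φ s ≤ Φ t
  Φ-mono seen≤ uncoloured≤ = +-mono-≤ (*-monoʳ-≤ 2 seen≤) uncoloured≤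

  Φ-empty : Φ empty ≤ suc (degree G x)
  Φ-empty = subst (λ d → 2 * d + #uncoloured empty ≤ suc (degree G x)) (sym #seen-empty)
                  (#uncoloured≤1+degree empty)

  module _ (s : State n k) (v : Fin n) (c : Fin k) where

    #uncoloured-assign-≤ : #uncoloured (assign s v c) ≤ #uncoloured s
    #uncoloured-assign-≤ = count-mono (uncoloured? _) (uncoloured? s) (map₂ (assign-nothing s v c))

    #uncoloured-assign-< : InClosedNbhd G x v → s v ≡ nothing →
                           #uncoloured (assign s v c) < #uncoloured s
    #uncoloured-assign-< v∈N[x] free =
      count-< (uncoloured? _) (uncoloured? s) (map₂ (assign-nothing s v c)) coloured (v∈N[x] , free)
      where
      coloured : ¬ Uncoloured (assign s v c) v
      coloured (_ , eq) = contradiction (trans (sym (assign-same s v c)) eq) λ ()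

    seen-assign : ∀ {c′} → Seen (assign s v c) c′ → (c ≡ c′ × InClosedNbhd G x v) ⊎ Seen s c′
    seen-assign (y , y∈N[x] , eq) with assign-just s v c {y} eq
    ... | inj₁ (refl , c≡c′) = inj₁ (c≡c′ , y∈N[x])
    ... | inj₂ eq′           = inj₂ (y , y∈N[x] , eq′)

    #seen-assign-≤-suc : #seen (assign s v c) ≤ suc (#seen s)
    #seen-assign-≤-suc = count-≤-suc (seen? _) (seen? s) c (map₁ proj₁ ∘ seen-assign)

    #seen-assign-seen : Seen s c → #seen (assign s v c) ≤ #seen s
    #seen-assign-seen c-seen =
      count-mono (seen? _) (seen? s) ([ (λ { (refl , _) → c-seen }) , id ]′ ∘ seen-assign)

    #seen-assign-outside : ¬ InClosedNbhd G x v → #seen (assign s v c) ≤ #seen s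
    #seen-assign-outside v∉N[x] =
      count-mono (seen? _) (seen? s) ([ (λ (_ , v∈N[x]) → contradiction v∈N[x] v∉N[x]) , id ]′ ∘ seen-assign)

    Φ-assign-outside : ¬ InClosedNbhd G x v → Φ (assign s v c) ≤ Φ s
    Φ-assign-outside v∉N[x] = Φ-mono (#seen-assign-outside v∉N[x]) #uncoloured-assign-≤

    Φ-assign-≤-suc : s v ≡ nothing → Φ (assign s v c) ≤ suc (Φ s)
    Φ-assign-≤-suc free with inN[x]? v
    ... | no v∉N[x]  = m≤n⇒m≤1+n (Φ-assign-outside v∉N[x])
    ... | yes v∈N[x] = begin
      2 * #seen (assign s v c) + #uncoloured (assign s v c)
        ≤⟨ +-monoˡ-≤ _ (*-monoʳ-≤ 2 #seen-assign-≤-suc) ⟩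
      2 * suc (#seen s) + #uncoloured (assign s v c)
        ≡⟨ cong (_+ #uncoloured (assign s v c)) (*-suc 2 (#seen s)) ⟩
      suc (suc (2 * #seen s + #uncoloured (assign s v c)))
        ≤⟨ s≤s (+-monoʳ-< (2 * #seen s) (#uncoloured-assign-< v∈N[x] free)) ⟩
      suc (Φ s)
        ∎
      where open ≤-Reasoning

    Φ-assign-seen : InClosedNbhd G x v → s v ≡ nothing → Seen s c → Φ (assign s v c) < Φ s
    Φ-assign-seen v∈N[x] free c-seen =
      +-mono-≤-< (*-monoʳ-≤ 2 (#seen-assign-seen c-seen)) (#uncoloured-assign-< v∈N[x] free)

    Φ-assign-unseen : InClosedNbhd G x v → s v ≡ nothing → #seen s ≡ 0 →
                      Φ (assign s v c) ≤ 2 + degree G x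
    Φ-assign-unseen v∈N[x] free none-seen = +-mono-≤ (*-monoʳ-≤ 2 #seen≤1) #uncoloured≤degree
      where
      #seen≤1 : #seen (assign s v c) ≤ 1
      #seen≤1 = ≤-trans #seen-assign-≤-suc (≤-reflexive (cong suc none-seen))
      #uncoloured≤degree : #uncoloured (assign s v c) ≤ degree G x
      #uncoloured≤degree = s≤s⁻¹ (≤-trans (#uncoloured-assign-< v∈N[x] free) (#uncoloured≤1+degree s))

  Invariant : Player → State n k → Set
  Invariant alice s = Φ s ≤ 2 + degree G x ⊎ (#uncoloured s ≡ 0 × Φ s ≤ 3 + degree G x)
  Invariant bob   s = Φ s ≤ 3 + degree G x

  invariant-empty : ∀ p → Invariant p empty
  invariant-empty alice = inj₁ (m≤n⇒m≤1+n Φ-empty)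
  invariant-empty bob   = m≤n⇒m≤1+n (m≤n⇒m≤1+n Φ-empty)

  Φ≤3+degree : ∀ {s} p → Invariant p s → Φ s ≤ 3 + degree G x
  Φ≤3+degree alice (inj₁ Φ≤2+d)      = m≤n⇒m≤1+n Φ≤2+d
  Φ≤3+degree alice (inj₂ (_ , Φ≤3+d)) = Φ≤3+d
  Φ≤3+degree bob   Φ≤3+d             = Φ≤3+d

  alice-move : ∀ {s v c} → Invariant alice s → s v ≡ nothing → Invariant bob (assign s v c)
  alice-move {s} {v} {c} (inj₁ Φ≤2+d) free = ≤-trans (Φ-assign-≤-suc s v c free) (s≤s Φ≤2+d)
  alice-move {s} {v} {c} (inj₂ (none-uncoloured , Φ≤3+d)) free =
    ≤-trans (Φ-assign-outside s v c v∉N[x]) Φ≤3+d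
    where
    v∉N[x] : ¬ InClosedNbhd G x v
    v∉N[x] v∈N[x] =
      n≮0 (subst (#uncoloured (assign s v c) <_) none-uncoloured (#uncoloured-assign-< s v c v∈N[x] free))

  bob-reply : ∀ {s} → Fin k → Invariant bob s → (∃ λ v → s v ≡ nothing) →
              ∃₂ λ v c → s v ≡ nothing × Invariant alice (assign s v c)
  bob-reply {s} c₀ Φ≤3+d (v₀ , free₀) with any? (uncoloured? s)
  ... | yes (v , v∈N[x] , free) with any? (seen? s)
  ...   | yes (c , c-seen) =
          v , c , free , inj₁ (s≤s⁻¹ (<-≤-trans (Φ-assign-seen s v c v∈N[x] free c-seen) Φ≤3+d))
  ...   | no none-seen =
          v , c₀ , free , inj₁ (Φ-assign-unseen s v c₀ v∈N[x] free #seen≡0)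
    where
    #seen≡0 : #seen s ≡ 0
    #seen≡0 = count-none (seen? s) (curry none-seen)
  bob-reply {s} c₀ Φ≤3+d (v₀ , free₀) | no none-uncoloured =
    v₀ , c₀ , free₀ , inj₂ (#uncoloured′≡0 , ≤-trans (Φ-assign-outside s v₀ c₀ v₀∉N[x]) Φ≤3+d)
    where
    v₀∉N[x] : ¬ InClosedNbhd G x v₀
    v₀∉N[x] v₀∈N[x] = none-uncoloured (v₀ , v₀∈N[x] , free₀)
    #uncoloured′≡0 : #uncoloured (assign s v₀ c₀) ≡ 0
    #uncoloured′≡0 = n≤0⇒n≡0 (≤-trans (#uncoloured-assign-≤ s v₀ c₀)
                                      (≤-reflexive (count-none (uncoloured? s) (curry none-uncoloured))))

  2k≤3+degree : ∀ {s p} → Fin k → AliceWins G s p → Invariant p s → 2 * k ≤ 3 + degree G x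
  2k≤3+degree {p = p} c₀ (finished _ dominates) inv =
    ≤-trans (≤-trans (*-monoʳ-≤ 2 (#seen-full dominates)) (m≤m+n _ _)) (Φ≤3+degree p inv)
  2k≤3+degree c₀ (aliceMove v c free win) inv = 2k≤3+degree c₀ win (alice-move inv free)
  2k≤3+degree c₀ (bobMove uncoloured win) inv with bob-reply c₀ inv uncoloured
  ... | v , c , free , inv′ = 2k≤3+degree c₀ (win v c free) inv′

game-bound : (G : Graph n) (x : Fin n) (p : Player) →
             AliceWins {k = k} G empty p → 2 * k ≤ 3 + degree G x
game-bound {k = zero}  G x p _   = z≤n
game-bound {k = suc k} G x p win = 2k≤3+degree fzero win (invariant-empty p)
  where open Potential G x

2*k≤1+m⇒2*k≤m : ∀ {m} → m % 2 ≡ 0 → 2 * k ≤ suc m → 2 * k ≤ m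
2*k≤1+m⇒2*k≤m {k} {m} m-even 2k≤1+m with m≤n⇒m<n∨m≡n 2k≤1+m
... | inj₁ 2k<1+m = s≤s⁻¹ 2k<1+m
... | inj₂ 2k≡1+m = contradiction (∣1⇒≡1 2∣1) λ ()
  where
  2∣1 : 2 ∣ 1
  2∣1 = ∣m+n∣m⇒∣n (subst (2 ∣_) (trans 2k≡1+m (+-comm 1 m)) (m∣m*n k)) (m%n≡0⇒n∣m m 2 m-even)

lemma4p1 : ∀ (m : ℕ) (G : Graph (suc m)) (δ : ℕ) → NoIsolatedVertices G → IsMinDegree G δ →
    (δ % 2 ≡ 1 → ∀ k → (AliceWinsAGame G k → 2 * k ≤ δ + 3) × (AliceWinsBGame G k → 2 * k ≤ δ + 3))
    × (δ % 2 ≡ 0 → ∀ k → (AliceWinsAGame G k → 2 * k ≤ δ + 2) × (AliceWinsBGame G k → 2 * k ≤ δ + 2))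
lemma4p1 m G δ _ ((x , degree≡δ) , _) =
  (λ _ k → bound alice , bound bob) ,
  (λ δ-even k → sharpen {k} δ-even ∘ bound alice , sharpen {k} δ-even ∘ bound bob)
  where
  bound : ∀ {k} p → AliceWins {k = k} G empty p → 2 * k ≤ δ + 3
  bound {k} p win = subst (2 * k ≤_) (trans (cong (3 +_) degree≡δ) (+-comm 3 δ)) (game-bound G x p win)
  sharpen : ∀ {k} → δ % 2 ≡ 0 → 2 * k ≤ δ + 3 → 2 * k ≤ δ + 2
  sharpen {k} δ-even 2k≤δ+3 =
    2*k≤1+m⇒2*k≤m {k} (trans ([m+n]%n≡m%n δ 2) δ-even) (subst (2 * k ≤_) (+-suc δ 2) 2k≤δ+3)
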